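{- Let $t=k_1\cdot x_1+\dots+k_r\cdot x_r$ be a homogeneous term and let $\eta$ be as below. For $p,q\in\mathbb Z$, there exist integers $N,a_1,\dots,a_r\geq 0$ with $N\geq\lceil\log_\varrho(1+\max\{a_1,\dots,a_r\})\rceil$ and $\varrho^Np+t[a_1,\dots,a_r]=q$ if and only if there is a word $w\in(\Sigma^r)^*$ with $\widehat\eta(p,w)=q$.
   Context: Fix an integer base $\varrho\geq2$ and $\Sigma=\{0,\dots,\varrho-1\}$. A homogeneous term is $0$ or $k_1\cdot x_1+\dots+k_r\cdot x_r$ with distinct variables and nonzero integer $k_i$; $t[a_1,\dots,a_r]=\sum k_ia_i$. The map $\eta:(\{q_I\}\cup\mathbb Z)\times\Sigma^r\to\{q_I\}\cup\mathbb Z$ ($q_I$ a new symbol) is defined by $\eta(q_I,\bar b)=t[\sigma(\bar b)]$ and $\eta(q,\bar b)=\varrho q+t[\bar b]$ for $q\in\mathbb Z$, where a letter $\bar b=(b_1,\dots,b_r)\in\Sigma^r$ is identified with the tuple $(b_1,\dots,b_r)$ and $\sigma(\bar b)=(c_1,\dots,c_r)$ with $c_i=0$ if $b_i=0$ and $c_i=-1$ otherwise. $\widehat\eta$ is its extension to words: $\widehat\eta(q,\lambda)=q$, $\widehat\eta(q,w\bar b)=\eta(\widehat\eta(q,w),\bar b)$. -}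

module Defs where

open import Data.Nat as ℕ using (ℕ; zero; suc; _^_; _≤?_)
open import Data.Integer as ℤ using (ℤ; +_; -[1+_])
open import Data.Fin using (Fin; toℕ) renaming (zero to fzero; suc to fsuc)
open import Data.List using (List; foldl)
open import Data.Vec.Functional using (Vector; foldr)
open import Relation.Nullary using (yes; no)

maxV : ∀ {r} → Vector ℕ r → ℕ
maxV = foldr ℕ._⊔_ 0

-- ⌈log_b m⌉ for m ≥ 1 (and b ≥ 2): the least N with m ≤ b^N.
-- Computed by searching N = 0, 1, ..., m  (m ≤ b^m whenever b ≥ 2).
clogFrom : ℕ → ℕ → ℕ → ℕ → ℕ
clogFrom b m N zero    = N
clogFrom b m N (suc k) with m ≤? b ^ N
... | yes _ = N
... | no  _ = clogFrom b m (suc N) k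

⌈log[_]_⌉ : ℕ → ℕ → ℕ
⌈log[ b ] m ⌉ = clogFrom b m 0 m

-- A homogeneous term in r variables is given by its coefficient vector k
-- (with all k i ≠ 0, imposed in the statement); evaluation t[a_1..a_r] = Σ k_i a_i.
evalTerm : ∀ {r} → Vector ℤ r → Vector ℤ r → ℤ
evalTerm {zero}  k a = + 0
evalTerm {suc r} k a = k fzero ℤ.* a fzero ℤ.+ evalTerm (λ i → k (fsuc i)) (λ i → a (fsuc i))

Letter : ℕ → ℕ → Set
Letter ϱ r = Vector (Fin ϱ) r

data State : Set where
  qI  : State
  int : ℤ → State

σdigit : ∀ {ϱ} → Fin ϱ → ℤ
σdigit d with toℕ d
... | zero  = + 0
... | suc _ = -[1+ 0 ]

η : ∀ ϱ {r} → Vector ℤ r → State → Letter ϱ r → State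
η ϱ k qI      b = int (evalTerm k (λ i → σdigit (b i)))
η ϱ k (int q) b = int (+ ϱ ℤ.* q ℤ.+ evalTerm k (λ i → + toℕ (b i)))

-- extension to words: η̂(q, λ) = q, η̂(q, w b) = η(η̂(q, w), b)
-- (words are lists read left to right)
η̂ : ∀ ϱ {r} → Vector ℤ r → State → List (Letter ϱ r) → State
η̂ ϱ k = foldl (η ϱ k)

{-# OPTIONS --safe #-}
module Submission where

-- Reading a word w from an integer state p produces ϱ^|w| p + t[a], where a_i is the
-- number whose base-ϱ digits, most significant first, are the i-th components of the
-- letters of w.  Conversely, a vector a with every a_i < ϱ^N is spelled by the N-letter
-- word of its zero-padded base-ϱ expansions, and ⌈log_ϱ(1 + max a)⌉ ≤ N says exactly
-- that every a_i < ϱ^N.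

open import Defs
open import Data.Nat using (ℕ; _≤_; _^_; _<_)
open import Data.Integer using (ℤ; +_; _+_; _*_)
open import Data.Fin using (Fin)
open import Data.List using (List)
open import Data.Product using (Σ; _×_; ∃)
open import Data.Vec.Functional using (Vector)
open import Relation.Binary.PropositionalEquality using (_≡_; _≢_)
open import Function.Bundles using (_⇔_)

open import Data.Nat as ℕ using (zero; suc; z≤n; s≤s; NonZero; _≤?_; _/_; _%_)
open import Data.Nat.Properties as ℕ
  using (≤-trans; ≤-<-trans; <⇒≤; m≤n⇒m<n∨m≡n; m≤m⊔n; m≤n⊔m; ⊔-lub;
         ^-monoʳ-≤; ^-monoʳ-<; m^n>0; +-identityʳ; +-suc)
open import Data.Nat.DivMod using (m%n<n; m≡m%n+[m/n]*n; m<n*o⇒m/o<n)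
import Data.Integer.Properties as ℤ
open import Data.Integer.Tactic.RingSolver using (solve-∀)
open import Data.Fin using (toℕ; fromℕ<) renaming (zero to fzero; suc to fsuc)
open import Data.Fin.Properties using (toℕ<n; toℕ-fromℕ<)
open import Data.Digit using (Expansion; fromDigits)
open import Data.List using ([]; _∷_; length; map; reverse; foldr)
open import Data.List.Properties using (length-map; reverse-foldl; reverse-involutive)
open import Data.Product using (_,_)
open import Data.Sum using (inj₁; inj₂)
open import Data.Empty using (⊥-elim)
open import Function.Bundles using (mk⇔; Equivalence)
import Function.Properties.Equivalence as ⇔
open import Relation.Binary.PropositionalEquality using (refl; sym; trans; cong; cong₂; subst; module ≡-Reasoning)
open import Relation.Nullary using (yes; no)

n<b^n : ∀ {b} → 2 ≤ b → ∀ n → n < b ^ n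
n<b^n 2≤b zero    = s≤s z≤n
n<b^n 2≤b (suc n) = ≤-<-trans (n<b^n 2≤b n) (^-monoʳ-< _ 2≤b (ℕ.n<1+n n))

clogFrom-≤ : ∀ b m N₀ k {N} → N₀ ≤ N → m ≤ b ^ N → clogFrom b m N₀ k ≤ N
clogFrom-≤ b m N₀ zero    N₀≤N m≤b^N = N₀≤N
clogFrom-≤ b m N₀ (suc k) N₀≤N m≤b^N with m ≤? b ^ N₀
... | yes _ = N₀≤N
... | no m≰b^N₀ with m≤n⇒m<n∨m≡n N₀≤N
...   | inj₁ N₀<N = clogFrom-≤ b m (suc N₀) k N₀<N m≤b^N
...   | inj₂ refl = ⊥-elim (m≰b^N₀ m≤b^N)

≤^clogFrom : ∀ b m N₀ k → m ≤ b ^ (N₀ ℕ.+ k) → m ≤ b ^ clogFrom b m N₀ k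
≤^clogFrom b m N₀ zero    m≤ = subst (λ N → m ≤ b ^ N) (+-identityʳ N₀) m≤
≤^clogFrom b m N₀ (suc k) m≤ with m ≤? b ^ N₀
... | yes m≤b^N₀ = m≤b^N₀
... | no _       = ≤^clogFrom b m (suc N₀) k (subst (λ N → m ≤ b ^ N) (+-suc N₀ k) m≤)

⌈log⌉≤⇔≤^ : ∀ {b} → 2 ≤ b → ∀ m N → ⌈log[ b ] m ⌉ ≤ N ⇔ m ≤ b ^ N
⌈log⌉≤⇔≤^ {b@(suc _)} 2≤b m N = mk⇔
  (λ clog≤N → ≤-trans (≤^clogFrom b m 0 m (<⇒≤ (n<b^n 2≤b m))) (^-monoʳ-≤ b clog≤N))
  (clogFrom-≤ b m 0 m z≤n)

maxV<⇔ : ∀ {r} (a : Vector ℕ r) {B} → 0 < B → maxV a < B ⇔ (∀ i → a i < B)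
maxV<⇔ a 0<B = mk⇔ (λ max<B i → ≤-<-trans (≤maxV a i) max<B) (maxV<-lub a 0<B)
  where
  ≤maxV : ∀ {r} (a : Vector ℕ r) i → a i ≤ maxV a
  ≤maxV a fzero    = m≤m⊔n (a fzero) _
  ≤maxV a (fsuc i) = ≤-trans (≤maxV (λ j → a (fsuc j)) i) (m≤n⊔m (a fzero) _)

  maxV<-lub : ∀ {r} (a : Vector ℕ r) {B} → 0 < B → (∀ i → a i < B) → maxV a < B
  maxV<-lub {zero}  a 0<B a<B = 0<B
  maxV<-lub {suc r} a 0<B a<B = ⊔-lub (a<B fzero) (maxV<-lub (λ j → a (fsuc j)) 0<B (λ j → a<B (fsuc j)))

⌈log[1+maxV]⌉≤⇔<^ : ∀ {b r} → 2 ≤ b → (a : Vector ℕ r) (N : ℕ) →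
                    ⌈log[ b ] (1 ℕ.+ maxV a) ⌉ ≤ N ⇔ (∀ i → a i < b ^ N)
⌈log[1+maxV]⌉≤⇔<^ {b@(suc _)} 2≤b a N =
  ⇔.trans (⌈log⌉≤⇔≤^ 2≤b _ N) (maxV<⇔ a (m^n>0 b N))

fromDigits<^length : ∀ {base} (ds : Expansion base) → fromDigits ds < base ^ length ds
fromDigits<^length         []       = s≤s z≤n
fromDigits<^length {base} (d ∷ ds) = begin-strict
  toℕ d ℕ.+ fromDigits ds ℕ.* base  <⟨ ℕ.+-monoˡ-< _ (toℕ<n d) ⟩
  base ℕ.+ fromDigits ds ℕ.* base   ≤⟨ ℕ.*-monoˡ-≤ base (fromDigits<^length ds) ⟩
  base ^ length ds ℕ.* base         ≡⟨ ℕ.*-comm (base ^ length ds) base ⟩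
  base ^ suc (length ds)            ∎
  where open ℕ.≤-Reasoning

padDigits : ∀ {base} .{{_ : NonZero base}} → ℕ → ℕ → Expansion base
padDigits         zero    n = []
padDigits {base} (suc N) n = fromℕ< (m%n<n n base) ∷ padDigits N (n / base)

fromDigits-padDigits : ∀ {base} .{{_ : NonZero base}} N {n} → n < base ^ N →
                       fromDigits (padDigits {base} N n) ≡ n
fromDigits-padDigits         zero    n<1 = sym (ℕ.n<1⇒n≡0 n<1)
fromDigits-padDigits {base} (suc N) {n} n<base^1+N = begin
  toℕ (fromℕ< (m%n<n n base)) ℕ.+ fromDigits (padDigits N (n / base)) ℕ.* base
    ≡⟨ cong₂ (λ d m → d ℕ.+ m ℕ.* base) (toℕ-fromℕ< _) (fromDigits-padDigits N n/base<base^N) ⟩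
  n % base ℕ.+ (n / base) ℕ.* base
    ≡⟨ m≡m%n+[m/n]*n n base ⟨
  n ∎
  where
  open ≡-Reasoning
  n/base<base^N : n / base < base ^ N
  n/base<base^N = m<n*o⇒m/o<n (subst (n <_) (ℕ.*-comm base (base ^ N)) n<base^1+N)

module _ {ϱ r : ℕ} where

  column : Fin r → List (Letter ϱ r) → Expansion ϱ
  column i = map (λ b → b i)

  -- The head of the list is the least significant digit.
  value : List (Letter ϱ r) → Vector ℕ r
  value w i = fromDigits (column i w)

  value<^length : ∀ w i → value w i < ϱ ^ length w
  value<^length w i =
    subst (λ n → value w i < ϱ ^ n) (length-map _ w) (fromDigits<^length (column i w))

  module _ .{{_ : NonZero ϱ}} where

    spell : ℕ → Vector ℕ r → List (Letter ϱ r)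
    spell zero    a = []
    spell (suc N) a = (λ i → fromℕ< (m%n<n (a i) ϱ)) ∷ spell N (λ i → a i / ϱ)

    length-spell : ∀ N a → length (spell N a) ≡ N
    length-spell zero    a = refl
    length-spell (suc N) a = cong suc (length-spell N _)

    column-spell : ∀ N a i → column i (spell N a) ≡ padDigits N (a i)
    column-spell zero    a i = refl
    column-spell (suc N) a i = cong (_ ∷_) (column-spell N _ i)

    value-spell : ∀ N {a} → (∀ i → a i < ϱ ^ N) → ∀ i → value (spell N a) i ≡ a i
    value-spell N {a} a<ϱ^N i =
      trans (cong fromDigits (column-spell N a i)) (fromDigits-padDigits N (a<ϱ^N i))

evalTerm-cong : ∀ {r} (k : Vector ℤ r) {x y : Vector ℤ r} →
                (∀ i → x i ≡ y i) → evalTerm k x ≡ evalTerm k y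
evalTerm-cong {zero}  k x≗y = refl
evalTerm-cong {suc r} k x≗y =
  cong₂ (λ x₀ t → k fzero * x₀ + t) (x≗y fzero) (evalTerm-cong (λ i → k (fsuc i)) (λ i → x≗y (fsuc i)))

evalTerm-zero : ∀ {r} (k : Vector ℤ r) → evalTerm k (λ _ → + 0) ≡ + 0
evalTerm-zero {zero}  k = refl
evalTerm-zero {suc r} k = cong₂ _+_ (ℤ.*-zeroʳ (k fzero)) (evalTerm-zero (λ i → k (fsuc i)))

evalTerm-+-* : ∀ {r} (k x y : Vector ℤ r) c →
               evalTerm k (λ i → x i + y i * c) ≡ evalTerm k x + evalTerm k y * c
evalTerm-+-* {zero}  k x y c = sym (ℤ.*-zeroˡ c)
evalTerm-+-* {suc r} k x y c = begin
  k₀ * (x fzero + y fzero * c) + evalTerm k′ (λ i → x′ i + y′ i * c)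
    ≡⟨ cong (λ t → k₀ * (x fzero + y fzero * c) + t) (evalTerm-+-* k′ x′ y′ c) ⟩
  k₀ * (x fzero + y fzero * c) + (evalTerm k′ x′ + evalTerm k′ y′ * c)
    ≡⟨ distribute k₀ (x fzero) (y fzero) c (evalTerm k′ x′) (evalTerm k′ y′) ⟩
  (k₀ * x fzero + evalTerm k′ x′) + (k₀ * y fzero + evalTerm k′ y′) * c ∎
  where
  open ≡-Reasoning
  k₀ = k fzero
  k′ x′ y′ : Vector ℤ r
  k′ i = k (fsuc i)
  x′ i = x (fsuc i)
  y′ i = y (fsuc i)
  distribute : ∀ k₀ x₀ y₀ c X Y → k₀ * (x₀ + y₀ * c) + (X + Y * c) ≡ (k₀ * x₀ + X) + (k₀ * y₀ + Y) * c
  distribute = solve-∀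

module _ (ϱ : ℕ) {r : ℕ} (k : Vector ℤ r) where

  foldr-η : ∀ p w → foldr (λ b s → η ϱ k s b) (int p) w ≡
                    int (+ (ϱ ^ length w) * p + evalTerm k (λ i → + value w i))
  foldr-η p [] = cong int (begin
    p                          ≡⟨ ℤ.+-identityʳ p ⟨
    p + + 0                    ≡⟨ cong₂ _+_ (ℤ.*-identityˡ p) (evalTerm-zero k) ⟨
    + 1 * p + evalTerm k _     ∎)
    where open ≡-Reasoning
  foldr-η p (b ∷ w) rewrite foldr-η p w = cong int (begin
    + ϱ * (+ (ϱ ^ n) * p + T) + B
      ≡⟨ shift (+ ϱ) (+ (ϱ ^ n)) p T B ⟩
    (+ ϱ * + (ϱ ^ n)) * p + (B + T * + ϱ)
      ≡⟨ cong₂ (λ c t → c * p + t) (ℤ.pos-* ϱ (ϱ ^ n)) (evalTerm-+-* k _ _ (+ ϱ)) ⟨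
    + (ϱ ^ suc n) * p + evalTerm k (λ i → + toℕ (b i) + + value w i * + ϱ)
      ≡⟨ cong (λ t → + (ϱ ^ suc n) * p + t) (evalTerm-cong k λ i →
           trans (ℤ.pos-+ (toℕ (b i)) _) (cong (λ t → + toℕ (b i) + t) (ℤ.pos-* (value w i) ϱ))) ⟨
    + (ϱ ^ suc n) * p + evalTerm k (λ i → + value (b ∷ w) i) ∎)
    where
    open ≡-Reasoning
    n = length w
    T = evalTerm k (λ i → + value w i)
    B = evalTerm k (λ i → + toℕ (b i))
    shift : ∀ a c p T B → a * (c * p + T) + B ≡ (a * c) * p + (B + T * a)
    shift = solve-∀

  -- η̂ consumes letters most significant first, whereas value reads its list least significant first.
  η̂-reverse : ∀ p w → η̂ ϱ k (int p) (reverse w) ≡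
                      int (+ (ϱ ^ length w) * p + evalTerm k (λ i → + value w i))
  η̂-reverse p w = trans (reverse-foldl (η ϱ k) (int p) w) (foldr-η p w)

  η̂-int : ∀ p w → η̂ ϱ k (int p) w ≡
                  int (+ (ϱ ^ length (reverse w)) * p + evalTerm k (λ i → + value (reverse w) i))
  η̂-int p w = trans (cong (η̂ ϱ k (int p)) (sym (reverse-involutive w))) (η̂-reverse p (reverse w))

  η̂-reverse-spell : .{{_ : NonZero ϱ}} → ∀ p N {a} → (∀ i → a i < ϱ ^ N) →
                    η̂ ϱ k (int p) (reverse (spell N a)) ≡ int (+ (ϱ ^ N) * p + evalTerm k (λ i → + a i))
  η̂-reverse-spell p N {a} a<ϱ^N = trans (η̂-reverse p (spell N a)) (cong int (cong₂ (λ n t → + (ϱ ^ n) * p + t)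
    (length-spell N a) (evalTerm-cong k (λ i → cong +_ (value-spell N a<ϱ^N i)))))

int-injective : ∀ {x y} → int x ≡ int y → x ≡ y
int-injective refl = refl

lemma3p5 : (ϱ : ℕ) → 2 ≤ ϱ → (r : ℕ) → (k : Vector ℤ r) → (∀ i → k i ≢ + 0) →
           (p q : ℤ) →
           (Σ ℕ λ N → Σ (Vector ℕ r) λ a →
              ⌈log[ ϱ ] (1 Data.Nat.+ maxV a) ⌉ ≤ N ×
              (+ (ϱ ^ N)) * p + evalTerm k (λ i → + a i) ≡ q)
           ⇔
           (Σ (List (Letter ϱ r)) λ w → η̂ ϱ k (int p) w ≡ int q)
lemma3p5 ϱ@(suc (suc _)) 2≤ϱ@(s≤s (s≤s _)) r k _ p q = mk⇔
  (λ (N , a , N-bound , t≡q) → reverse (spell N a) ,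
     trans (η̂-reverse-spell ϱ k p N (Equivalence.to (⌈log[1+maxV]⌉≤⇔<^ 2≤ϱ a N) N-bound)) (cong int t≡q))
  (λ (w , η̂≡q) → let ds = reverse w in length ds , value ds ,
     Equivalence.from (⌈log[1+maxV]⌉≤⇔<^ 2≤ϱ (value ds) (length ds)) (value<^length ds) ,
     int-injective (trans (sym (η̂-int ϱ k p w)) η̂≡q))
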